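{- Let $G$ be a group, $s$ a central involution of $G$, $n\ge 3$, and $\psi$ a gain function on the complete graph $K_n$ over $G$ such that $\psi(v_0,v_1)\psi(v_1,v_2)\psi(v_2,v_0)=s$ for every three distinct vertices $v_0,v_1,v_2$. Then $\psi\sim\mathbf{s}$. In particular, a $G$-gain graph whose underlying graph is complete is balanced if and only if all its gain subgraphs induced by three vertices are balanced.
   Context: A gain function on a simple graph over $G$ is a map $\psi$ from ordered pairs $(u,v)$ of adjacent vertices to $G$ with $\psi(v,u)=\psi(u,v)^{ -1}$. The gain of a walk $W=v_0,\dots,v_\ell$ is $\psi(W)=\psi(v_0,v_1)\cdots\psi(v_{\ell-1},v_\ell)$; a gain graph is balanced if $\psi(W)=1_G$ for every closed walk $W$ ($v_0=v_\ell$). Two gain functions $\psi_1,\psi_2$ are switching equivalent ($\psi_1\sim\psi_2$) if there is $f\colon V\to G$ with $\psi_2(u,v)=f(u)^{ -1}\psi_1(u,v)f(v)$ for all adjacent $u,v$. A central involution $s$ satisfies $s^2=1_G$ and commutes with all of $G$; $\mathbf{s}$ is the constant gain function with value $s$. The subgraph induced by a vertex set carries the restricted gain function. -}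

module Defs where

open import Level using (_⊔_)
open import Algebra.Bundles using (Group)
open import Data.Nat using (ℕ)
open import Data.Fin using (Fin)
open import Data.Product using (Σ; _×_)
open import Data.Sum using (_⊎_)
open import Data.Unit using (⊤)
open import Relation.Binary.PropositionalEquality using (_≡_; _≢_)

module GainGraph {c ℓ} (G : Group c ℓ) where
  open Group G

  -- A gain function on K_n: values ψ u v on ordered pairs of adjacent
  -- (i.e. distinct) vertices; diagonal values are irrelevant and never used.
  GainFn : ℕ → Set c
  GainFn n = Fin n → Fin n → Carrier

  IsGainFunction : ∀ {n} → GainFn n → Set ℓ
  IsGainFunction {n} ψ = ∀ (u v : Fin n) → u ≢ v → ψ v u ≈ ψ u v ⁻¹

  IsCentralInvolution : Carrier → Set (c ⊔ ℓ)
  IsCentralInvolution s = (s ∙ s ≈ ε) × (∀ g → s ∙ g ≈ g ∙ s)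

  SwitchingEquivalent : ∀ {n} → GainFn n → GainFn n → Set (c ⊔ ℓ)
  SwitchingEquivalent {n} ψ₁ ψ₂ =
    Σ (Fin n → Carrier) λ f →
      ∀ (u v : Fin n) → u ≢ v → ψ₂ u v ≈ (f u ⁻¹ ∙ ψ₁ u v) ∙ f v

  const𝐬 : ∀ {n} → Carrier → GainFn n
  const𝐬 s _ _ = s

  -- Walks in the subgraph of K_n induced by the vertex set P, from u to w.
  -- (The start vertex u is required to lie in P separately.)
  data Walk {n} (P : Fin n → Set) : Fin n → Fin n → Set where
    stop : ∀ {u} → Walk P u u
    step : ∀ {u v w} → u ≢ v → P v → Walk P v w → Walk P u w

  gain : ∀ {n} {P : Fin n → Set} → GainFn n → ∀ {u w} → Walk P u w → Carrier
  gain ψ stop = ε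
  gain ψ (step {u} {v} _ _ W) = ψ u v ∙ gain ψ W

  BalancedOn : ∀ {n} → (Fin n → Set) → GainFn n → Set ℓ
  BalancedOn {n} P ψ = ∀ (u : Fin n) → P u → (W : Walk P u u) → gain ψ W ≈ ε

  Balanced : ∀ {n} → GainFn n → Set ℓ
  Balanced ψ = BalancedOn (λ _ → ⊤) ψ

  Three : ∀ {n} → Fin n → Fin n → Fin n → Fin n → Set
  Three a b c v = (v ≡ a) ⊎ ((v ≡ b) ⊎ (v ≡ c))

-- Fix a root vertex r and put a(r) = s and a(v) = ψ(r,v) for v ≠ r.  The
-- triangle condition through r, together with ψ(v,r) = ψ(r,v)⁻¹, says that
-- (a(u) ψ(u,v)) a(v)⁻¹ = s for all u ≠ v, and switching by f(v) = a(v)⁻¹ s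
-- then turns ψ into the constant s; only s² = 1 is used, never centrality.
-- For s = 1 this makes a complete gain graph whose triangles are balanced
-- switching equivalent to the trivial one, hence balanced.
module Submission where

open import Defs
open import Algebra.Bundles using (Group)
import Algebra.Properties.Group as GroupProperties
open import Data.Nat using (ℕ; suc; _≤_; s≤s)
open import Data.Fin using (Fin; zero; suc)
open import Data.Product using (_×_; _,_)
open import Data.Sum using (inj₁; inj₂)
open import Data.Unit using (tt)
open import Relation.Binary.PropositionalEquality using (_≡_; _≢_; ≢-sym)
import Relation.Binary.PropositionalEquality as ≡
open import Relation.Nullary using (contradiction)
import Relation.Binary.Reasoning.Setoid as SetoidReasoning

module GainGraphProperties {c ℓ} (G : Group c ℓ) where
  open Group G
  open GroupProperties G
  open SetoidReasoning setoid hiding (stop)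
  open GainGraph G

  involution⇒⁻¹≈id : ∀ {s} → s ∙ s ≈ ε → s ⁻¹ ≈ s
  involution⇒⁻¹≈id {s} s²≈ε = sym (inverseˡ-unique s s s²≈ε)

  switch-triangle : ∀ {s} a b c → s ∙ s ≈ ε → (a ∙ b) ∙ c ⁻¹ ≈ s →
                    s ≈ ((a ⁻¹ ∙ s) ⁻¹ ∙ b) ∙ (c ⁻¹ ∙ s)
  switch-triangle {s} a b c s²≈ε abc⁻¹≈s = sym (begin
    ((a ⁻¹ ∙ s) ⁻¹ ∙ b) ∙ (c ⁻¹ ∙ s)     ≈⟨ ∙-congʳ (∙-congʳ (⁻¹-anti-homo-∙ (a ⁻¹) s)) ⟩
    ((s ⁻¹ ∙ a ⁻¹ ⁻¹) ∙ b) ∙ (c ⁻¹ ∙ s)  ≈⟨ ∙-congʳ (∙-congʳ (∙-cong (involution⇒⁻¹≈id s²≈ε) (⁻¹-involutive a))) ⟩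
    ((s ∙ a) ∙ b) ∙ (c ⁻¹ ∙ s)           ≈⟨ assoc _ (c ⁻¹) s ⟨
    (((s ∙ a) ∙ b) ∙ c ⁻¹) ∙ s           ≈⟨ ∙-congʳ (trans (∙-congʳ (assoc s a b)) (assoc s (a ∙ b) (c ⁻¹))) ⟩
    (s ∙ ((a ∙ b) ∙ c ⁻¹)) ∙ s           ≈⟨ ∙-congʳ (∙-congˡ abc⁻¹≈s) ⟩
    (s ∙ s) ∙ s                          ≈⟨ ∙-congʳ s²≈ε ⟩
    ε ∙ s                                ≈⟨ identityˡ s ⟩
    s                                    ∎)

  Walk-map : ∀ {n} {P Q : Fin n → Set} → (∀ {v} → P v → Q v) →
             ∀ {u w} → Walk P u w → Walk Q u w
  Walk-map P⊆Q stop            = stop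
  Walk-map P⊆Q (step u≢v Pv W) = step u≢v (P⊆Q Pv) (Walk-map P⊆Q W)

  gain-Walk-map : ∀ {n} {P Q : Fin n → Set} (ψ : GainFn n) (P⊆Q : ∀ {v} → P v → Q v) →
                  ∀ {u w} (W : Walk P u w) → gain ψ (Walk-map P⊆Q W) ≡ gain ψ W
  gain-Walk-map ψ P⊆Q stop                 = ≡.refl
  gain-Walk-map ψ P⊆Q (step {u} {v} _ _ W) = ≡.cong (ψ u v ∙_) (gain-Walk-map ψ P⊆Q W)

  balancedOn-mono : ∀ {n} {P Q : Fin n → Set} {ψ : GainFn n} → (∀ {v} → P v → Q v) →
                    BalancedOn Q ψ → BalancedOn P ψ
  balancedOn-mono {ψ = ψ} P⊆Q balanced u Pu W =
    trans (reflexive (≡.sym (gain-Walk-map ψ P⊆Q W))) (balanced u (P⊆Q Pu) (Walk-map P⊆Q W))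

  gain-switch : ∀ {n} {P : Fin n → Set} {ψ₁ ψ₂ : GainFn n} (f : Fin n → Carrier) →
                (∀ u v → u ≢ v → ψ₂ u v ≈ (f u ⁻¹ ∙ ψ₁ u v) ∙ f v) →
                ∀ {u w} (W : Walk P u w) → gain ψ₂ W ≈ (f u ⁻¹ ∙ gain ψ₁ W) ∙ f w
  gain-switch f _ {u} stop = begin
    ε                    ≈⟨ inverseˡ (f u) ⟨
    f u ⁻¹ ∙ f u         ≈⟨ ∙-congʳ (identityʳ (f u ⁻¹)) ⟨
    (f u ⁻¹ ∙ ε) ∙ f u   ∎
  gain-switch {ψ₁ = ψ₁} {ψ₂} f switch {u} {w} (step {v = v} u≢v _ W) = begin
    ψ₂ u v ∙ gain ψ₂ W                                        ≈⟨ ∙-cong (switch u v u≢v) (gain-switch f switch W) ⟩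
    ((f u ⁻¹ ∙ ψ₁ u v) ∙ f v) ∙ ((f v ⁻¹ ∙ gain ψ₁ W) ∙ f w)  ≈⟨ ∙-congˡ (assoc _ _ _) ⟩
    ((f u ⁻¹ ∙ ψ₁ u v) ∙ f v) ∙ (f v ⁻¹ ∙ (gain ψ₁ W ∙ f w))  ≈⟨ assoc _ _ _ ⟩
    (f u ⁻¹ ∙ ψ₁ u v) ∙ (f v ∙ (f v ⁻¹ ∙ (gain ψ₁ W ∙ f w)))  ≈⟨ ∙-congˡ (\\-leftDividesˡ (f v) _) ⟩
    (f u ⁻¹ ∙ ψ₁ u v) ∙ (gain ψ₁ W ∙ f w)                     ≈⟨ assoc _ _ _ ⟨
    ((f u ⁻¹ ∙ ψ₁ u v) ∙ gain ψ₁ W) ∙ f w                     ≈⟨ ∙-congʳ (assoc _ _ _) ⟩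
    (f u ⁻¹ ∙ (ψ₁ u v ∙ gain ψ₁ W)) ∙ f w                     ∎

  balancedOn-switching : ∀ {n} {P : Fin n → Set} {ψ₁ ψ₂ : GainFn n} →
                         SwitchingEquivalent ψ₁ ψ₂ → BalancedOn P ψ₂ → BalancedOn P ψ₁
  balancedOn-switching {ψ₁ = ψ₁} (f , switch) balanced₂ u Pu W = begin
    gain ψ₁ W                              ≈⟨ \\-leftDividesʳ (f u ⁻¹) (gain ψ₁ W) ⟨
    f u ⁻¹ ⁻¹ ∙ (f u ⁻¹ ∙ gain ψ₁ W)       ≈⟨ ∙-congˡ (inverseˡ-unique _ _ conjugate≈ε) ⟩
    f u ⁻¹ ⁻¹ ∙ f u ⁻¹                     ≈⟨ inverseˡ (f u ⁻¹) ⟩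
    ε                                      ∎
    where
    conjugate≈ε : (f u ⁻¹ ∙ gain ψ₁ W) ∙ f u ≈ ε
    conjugate≈ε = trans (sym (gain-switch f switch W)) (balanced₂ u Pu W)

  gain-trivial : ∀ {n} {P : Fin n → Set} {u w} (W : Walk P u w) → gain (const𝐬 ε) W ≈ ε
  gain-trivial stop         = refl
  gain-trivial (step _ _ W) = trans (identityˡ _) (gain-trivial W)

  balancedOn-trivial : ∀ {n} {P : Fin n → Set} → BalancedOn P (const𝐬 ε)
  balancedOn-trivial _ _ = gain-trivial

  balanced-triangle-gain : ∀ {n} {ψ : GainFn n} {a b d : Fin n} →
                           a ≢ b → b ≢ d → a ≢ d → BalancedOn (Three a b d) ψ →
                           (ψ a b ∙ ψ b d) ∙ ψ d a ≈ ε
  balanced-triangle-gain {ψ = ψ} {a} {b} {d} a≢b b≢d a≢d balanced = begin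
    (ψ a b ∙ ψ b d) ∙ ψ d a          ≈⟨ assoc _ _ _ ⟩
    ψ a b ∙ (ψ b d ∙ ψ d a)          ≈⟨ ∙-congˡ (∙-congˡ (identityʳ (ψ d a))) ⟨
    gain ψ triangle                  ≈⟨ balanced a (inj₁ ≡.refl) triangle ⟩
    ε                                ∎
    where
    triangle : Walk (Three a b d) a a
    triangle = step a≢b (inj₂ (inj₁ ≡.refl)) (step b≢d (inj₂ (inj₂ ≡.refl))
                 (step (≢-sym a≢d) (inj₁ ≡.refl) stop))

  TriangleGain : ∀ {n} → Carrier → GainFn n → Set ℓ
  TriangleGain {n} s ψ = ∀ (v₀ v₁ v₂ : Fin n) → v₀ ≢ v₁ → v₁ ≢ v₂ → v₀ ≢ v₂ →
                         (ψ v₀ v₁ ∙ ψ v₁ v₂) ∙ ψ v₂ v₀ ≈ s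

  module _ {m} {s} (s²≈ε : s ∙ s ≈ ε) (ψ : GainFn (suc m)) (isGain : IsGainFunction ψ)
           (triangle : TriangleGain s ψ) where

    rootGain : Fin (suc m) → Carrier
    rootGain zero    = s
    rootGain (suc v) = ψ zero (suc v)

    triangle-through-root : ∀ u v → u ≢ v →
                            (rootGain u ∙ ψ u v) ∙ rootGain v ⁻¹ ≈ s
    triangle-through-root zero    zero    u≢v = contradiction ≡.refl u≢v
    triangle-through-root zero    (suc v) _   = //-rightDividesʳ (ψ zero (suc v)) s
    triangle-through-root (suc u) zero    _   = begin
      (ψ zero (suc u) ∙ ψ (suc u) zero) ∙ s ⁻¹  ≈⟨ ∙-congʳ (trans (∙-congˡ (isGain zero (suc u) λ ())) (inverseʳ _)) ⟩
      ε ∙ s ⁻¹                                  ≈⟨ identityˡ (s ⁻¹) ⟩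
      s ⁻¹                                      ≈⟨ involution⇒⁻¹≈id s²≈ε ⟩
      s                                         ∎
    triangle-through-root (suc u) (suc v) u≢v = begin
      (ψ zero (suc u) ∙ ψ (suc u) (suc v)) ∙ ψ zero (suc v) ⁻¹  ≈⟨ ∙-congˡ (isGain zero (suc v) λ ()) ⟨
      (ψ zero (suc u) ∙ ψ (suc u) (suc v)) ∙ ψ (suc v) zero     ≈⟨ triangle zero (suc u) (suc v) (λ ()) u≢v (λ ()) ⟩
      s                                                         ∎

    switching-to-constant : SwitchingEquivalent ψ (const𝐬 s)
    switching-to-constant =
      (λ v → rootGain v ⁻¹ ∙ s) ,
      λ u v u≢v → switch-triangle _ _ _ s²≈ε (triangle-through-root u v u≢v)

lemma2p15 : ∀ {c ℓ} (G : Group c ℓ) (n : ℕ) → 3 ≤ n →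
    let open Group G
        open GainGraph G
    in (∀ (s : Carrier) → IsCentralInvolution s →
          ∀ (ψ : GainFn n) → IsGainFunction ψ →
          (∀ (v₀ v₁ v₂ : Fin n) → v₀ ≢ v₁ → v₁ ≢ v₂ → v₀ ≢ v₂ →
             (ψ v₀ v₁ ∙ ψ v₁ v₂) ∙ ψ v₂ v₀ ≈ s) →
          SwitchingEquivalent ψ (const𝐬 s))
     × (∀ (ψ : GainFn n) → IsGainFunction ψ →
          (Balanced ψ →
             ∀ (a b d : Fin n) → a ≢ b → b ≢ d → a ≢ d → BalancedOn (Three a b d) ψ)
        × ((∀ (a b d : Fin n) → a ≢ b → b ≢ d → a ≢ d → BalancedOn (Three a b d) ψ) →
             Balanced ψ))
-- A single root vertex is all the argument needs, so n ≥ 1 would suffice.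
lemma2p15 G (suc _) (s≤s _) =
  (λ s (s²≈ε , _) → switching-to-constant s²≈ε) ,
  λ ψ isGain →
    (λ balanced _ _ _ _ _ _ → balancedOn-mono (λ _ → tt) balanced) ,
    λ trianglesBalanced →
      let trivialTriangles : TriangleGain ε ψ
          trivialTriangles a b d a≢b b≢d a≢d =
            balanced-triangle-gain a≢b b≢d a≢d (trianglesBalanced a b d a≢b b≢d a≢d)
      in balancedOn-switching (switching-to-constant (identityʳ ε) ψ isGain trivialTriangles)
                              balancedOn-trivial
  where
  open Group G
  open GainGraphProperties G
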